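{- Let $\mathfrak{M}=\langle\Delta,\Pi,\sigma,\gamma\rangle$ be a standpoint structure over $\langle\mathbf{P}\uplus\mathbf{P}_{\mathtt{E}},\emptyset,\{*\}\rangle$ with $|\Pi|=2^m$, where $\mathbf{P}_{\mathtt{E}}=\{\mathtt{E}_0,\dots,\mathtt{E}_\ell\}$ consists of unary predicates. Then all predicates in $\mathbf{P}_{\mathtt{E}}$ are rigid in $\mathfrak{M}$ if and only if $\mathcal{I}^{\mathfrak{M}}\models\phi^\ell_{\mathrm{rig}\mathtt{E}}$.
   Context: A standpoint structure $\langle\Delta,\Pi,\sigma,\gamma\rangle$ over a signature whose only standpoint symbol is $*$: nonempty domain $\Delta$, set of precisifications $\Pi$, $\sigma(*)=\Pi$, $\gamma(\pi)$ interprets the (unary and binary) predicates over $\Delta$. A predicate is rigid if its interpretation is the same in every precisification. Stacked interpretation $\mathcal{I}^{\mathfrak{M}}$ (with $\Pi$ ordered as $\pi_0,\dots,\pi_{2^m-1}$): first-order interpretation with domain $\Delta\times\{0,\dots,2^m-1\}$; fresh unary $\mathtt{L}_j$ ($0\le j<m$) with $\mathtt{L}_j^{\mathcal{I}}=\{(\delta,i)\mid$ bit of weight $2^j$ of $i$ is $1\}$; fresh binary $\mathtt{F}^{\mathcal{I}}=\{((\delta,i),(\delta,i+1))\mid\delta\in\Delta,0\le i<2^m-1\}$; each unary predicate $P$ interpreted as $\bigcup_i P^{\gamma(\pi_i)}\times\{i\}$; each binary $P$ as $\{((\delta_1,i),(\delta_2,i))\mid(\delta_1,\delta_2)\in P^{\gamma(\pi_i)}\}$.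 $\phi^\ell_{\mathrm{rig}\mathtt{E}}$ is the sentence $\forall x.\forall y.\mathtt{F}(x,y)\to\bigwedge_{0\le i\le\ell}(\mathtt{E}_i(x)\leftrightarrow\mathtt{E}_i(y))$. -}

module Defs where

open import Data.Nat using (ℕ; suc; _^_; _≤_)
open import Data.Nat.DivMod using (_/_; _%_)
open import Data.Nat.Properties using (m^n≢0)
open import Data.Fin using (Fin; toℕ)
open import Data.Product using (_×_; _,_)
open import Data.Sum using (_⊎_; inj₁; inj₂)
open import Data.Unit using (⊤)
open import Function.Bundles using (_⤖_; Func; Bijection; _⇔_)
open import Relation.Binary.PropositionalEquality using (_≡_)

record Interp (U B : Set) (D : Set) : Set₁ where
  field
    unary  : U → D → Set
    binary : B → D → D → Set

-- Signature ⟨P ⊎ P_E, ∅, {*}⟩: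
--   P  consists of unary symbols PU and binary symbols PB,
--   P_E = {E_0, …, E_ℓ} unary symbols, indexed by Fin (suc ℓ),
--   no constants, the only standpoint symbol is *.
UnarySyms : (PU : Set) (ℓ : ℕ) → Set
UnarySyms PU ℓ = PU ⊎ Fin (suc ℓ)

data StandpointSym : Set where
  * : StandpointSym

record StandpointStructure (PU PB : Set) (ℓ m : ℕ) : Set₁ where
  field
    Δ        : Set
    nonempty : Δ
    Π        : Set
    enum     : Fin (2 ^ m) ⤖ Π
    σ        : StandpointSym → Π → Set
    σ-*      : ∀ π → σ * π
    γ        : Π → Interp (UnarySyms PU ℓ) PB Δ

  prec : Fin (2 ^ m) → Π
  prec i = Bijection.to enum i

  E^ : Π → Fin (suc ℓ) → Δ → Set
  E^ π k = Interp.unary (γ π) (inj₂ k)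

RigidUnary : ∀ {PU PB ℓ m} (𝔐 : StandpointStructure PU PB ℓ m) →
             UnarySyms PU ℓ → Set
RigidUnary 𝔐 P = ∀ (π π′ : Π) (δ : Δ) →
  (Interp.unary (γ π) P δ ⇔ Interp.unary (γ π′) P δ)
  where open StandpointStructure 𝔐

AllERigid : ∀ {PU PB ℓ m} (𝔐 : StandpointStructure PU PB ℓ m) → Set
AllERigid {ℓ = ℓ} 𝔐 = ∀ (k : Fin (suc ℓ)) → RigidUnary 𝔐 (inj₂ k)

StackedUnary : (PU : Set) (ℓ m : ℕ) → Set
StackedUnary PU ℓ m = UnarySyms PU ℓ ⊎ Fin m      -- inj₂ j = L_j

StackedBinary : (PB : Set) → Set
StackedBinary PB = PB ⊎ ⊤                          -- inj₂ _ = F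

bit : ℕ → ℕ → ℕ
bit n j = (_/_ n (2 ^ j) {{m^n≢0 2 j}}) % 2

stacked : ∀ {PU PB ℓ m} (𝔐 : StandpointStructure PU PB ℓ m) →
          Interp (StackedUnary PU ℓ m) (StackedBinary PB)
                 (StandpointStructure.Δ 𝔐 × Fin (2 ^ m))
stacked 𝔐 = record { unary = un ; binary = bin }
  where
  open StandpointStructure 𝔐
  un : _ → _ → Set
  un (inj₁ P) (δ , i) = Interp.unary (γ (prec i)) P δ
  un (inj₂ j) (δ , i) = bit (toℕ i) (toℕ j) ≡ 1
  bin : _ → _ → _ → Set
  bin (inj₁ P) (δ₁ , i₁) (δ₂ , i₂) = i₁ ≡ i₂ × Interp.binary (γ (prec i₁)) P δ₁ δ₂
  bin (inj₂ _) (δ₁ , i₁) (δ₂ , i₂) = δ₁ ≡ δ₂ × toℕ i₂ ≡ suc (toℕ i₁)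

Models-φrigE : ∀ {PU PB ℓ m D} → Interp (StackedUnary PU ℓ m) (StackedBinary PB) D → Set
Models-φrigE {ℓ = ℓ} {D = D} I = ∀ (x y : D) →
  Interp.binary I (inj₂ _) x y →
  ∀ (i : Fin (suc ℓ)) →
    (Interp.unary I (inj₁ (inj₂ i)) x ⇔ Interp.unary I (inj₁ (inj₂ i)) y)

-- Fᴵ links (δ, i) to (δ, i+1) only, so φ_rigE says that each Eₖ(δ) is unchanged
-- between consecutive precisifications π_i, π_{i+1}; chaining these steps along
-- 0, 1, …, 2^m − 1 reaches every precisification, which is rigidity.
module Submission where

open import Defs
open import Data.Nat using (ℕ; suc)
open import Data.Fin using (Fin; zero; suc; toℕ; inject₁)
open import Data.Fin.Properties using (toℕ-inject₁)
open import Data.Product using (_,_)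
open import Function.Bundles using (_⇔_; mk⇔; Bijection)
open import Function.Construct.Composition using (_⇔-∘_)
open import Function.Construct.Identity using (⇔-id)
open import Function.Construct.Symmetry using (⇔-sym)
open import Relation.Binary.PropositionalEquality using (_≡_; refl; sym; cong)

⇔-zero-of-successor-steps : ∀ {n} (P : Fin (suc n) → Set) →
  (∀ (i : Fin n) → P (inject₁ i) ⇔ P (suc i)) →
  ∀ i → P i ⇔ P zero
⇔-zero-of-successor-steps P step zero = ⇔-id (P zero)
⇔-zero-of-successor-steps {suc n} P step (suc i) =
  ⇔-zero-of-successor-steps (λ j → P (inject₁ j)) (λ j → step (inject₁ j)) i
    ⇔-∘ ⇔-sym (step i)

⇔-all-of-adjacent : ∀ {n} (P : Fin n → Set) →
  (∀ i j → toℕ j ≡ suc (toℕ i) → P i ⇔ P j) →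
  ∀ i j → P i ⇔ P j
⇔-all-of-adjacent {suc n} P adjacent i j =
  ⇔-sym (to-zero j) ⇔-∘ to-zero i
  where
  to-zero : ∀ i → P i ⇔ P zero
  to-zero = ⇔-zero-of-successor-steps P
    (λ i → adjacent (inject₁ i) (suc i) (cong suc (sym (toℕ-inject₁ i))))

lemma5 : ∀ {PU PB : Set} {ℓ m : ℕ} (𝔐 : StandpointStructure PU PB ℓ m) →
    AllERigid 𝔐 ⇔ Models-φrigE (stacked 𝔐)
lemma5 𝔐 = mk⇔ rigid⇒φ φ⇒rigid
  where
  open StandpointStructure 𝔐

  rigid⇒φ : AllERigid 𝔐 → Models-φrigE (stacked 𝔐)
  rigid⇒φ rigid (δ , i) (δ , j) (refl , _) k = rigid k (prec i) (prec j) δ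

  φ⇒rigid : Models-φrigE (stacked 𝔐) → AllERigid 𝔐
  φ⇒rigid φ k π π′ δ
    with Bijection.strictlySurjective enum π | Bijection.strictlySurjective enum π′
  ... | i , refl | j , refl =
    ⇔-all-of-adjacent (λ i → E^ (prec i) k δ)
      (λ i j i+1≡j → φ (δ , i) (δ , j) (refl , i+1≡j) k) i j
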